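{- For integers $m\ge1$ and $d\ge 1$, let $\Delta_{d-1}(m)$ denote the set $\{(i_1,\ldots,i_d)\in\mathbb{Z}_+^d: i_1+\cdots+i_d-(d-1)\le m\}$. Then $$\sum_{\pi\in\mathcal{P}^{(d)},\ \mathrm{sh}(\pi)\subseteq \Delta_{d-1}(m)} t^{\mathrm{cor}(\pi)} q^{|\pi|_{ch}} = \prod_{n = 1}^m (1 - t q^{n})^{ -\binom{n + d - 2}{d - 1}}.$$
   Context: A $d$-dimensional partition is an array $\pi=(\pi_{\mathbf{i}})_{\mathbf{i}\in\mathbb{Z}_+^d}$ of nonnegative integers with finitely many nonzero entries, weakly decreasing in each coordinate; $\mathcal{P}^{(d)}$ is their set; $\mathrm{sh}(\pi)=\{\mathbf{i}:\pi_{\mathbf{i}}>0\}$. (In the paper, $\Delta_{d-1}(m)$ is the $(d-1)$-dimensional "pyramid" partition whose diagram is the set above.) $D(\pi)=\{(i_1,\ldots,i_d,i)\in\mathbb{Z}_+^{d+1}:1\le i\le\pi_{i_1,\ldots,i_d}\}$, $\mathrm{Cor}(\pi)=\{\mathbf{i}\in D(\pi):\mathbf{i}+\mathbf{e}_\ell\notin D(\pi)\ \forall\ell\in[d]\}$, $\mathrm{cor}(\pi)=|\mathrm{Cor}(\pi)|$. For $\mathbf{i}=(i_1,\ldots,i_d)$, $\mathrm{ch}(\mathbf{i})=i_1+\cdots+i_d-d+1$; $|\pi|_{ch}=\sum_{(\mathbf{i},i_{d+1})\in\mathrm{Cor}(\pi)}\mathrm{ch}(\mathbf{i})$. -}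

module Defs where

open import Data.Nat using (ℕ; zero; suc; _+_; _*_; _∸_; _≤_; _<_; _<?_)
open import Data.Nat.Combinatorics using (_C_)
open import Data.Nat.Properties using (_≟_)
open import Data.Fin using (Fin)
open import Data.Fin.Properties using (all?)
open import Data.Vec using (Vec; []; _∷_; _[_]%=_)
import Data.Vec as Vec
open import Data.Nat.ListAction using (sum)
open import Data.List using (List; []; _∷_; map; upTo; concatMap; filter; length)
open import Data.List.Relation.Unary.All using (All)
open import Data.List.Relation.Unary.Any using (Any)
open import Data.List.Relation.Unary.AllPairs using (AllPairs)
open import Data.Product using (Σ; _×_)
open import Relation.Nullary using (¬_; yes; no)
open import Relation.Binary.PropositionalEquality using (_≡_; _≗_)

-- Indexing convention: an index i = (i₁,…,i_d) ∈ ℤ₊^d is encoded by the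
-- 0-based vector v = (i₁-1,…,i_d-1) ∈ ℕ^d.  A d-dimensional partition is
-- then a function π : Vec ℕ d → ℕ (value π_i stored at v).

Index : ℕ → Set
Index d = Vec ℕ d

_+e_ : ∀ {d} → Index d → Fin d → Index d
v +e ℓ = v [ ℓ ]%= suc

Decreasing : ∀ {d} → (Index d → ℕ) → Set
Decreasing {d} π = ∀ (v : Index d) (ℓ : Fin d) → π (v +e ℓ) ≤ π v

-- sum of coordinates of the 0-based vector; for i = v + (1,…,1),
-- i₁+⋯+i_d-(d-1) = vsum v + 1 and ch(i) = vsum v + 1.
vsum : ∀ {d} → Index d → ℕ
vsum = Vec.sum

ch : ∀ {d} → Index d → ℕ
ch v = suc (vsum v)

InΔ : ∀ {d} → ℕ → Index d → Set
InΔ m v = ch v ≤ m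

ShapeInΔ : ∀ {d} → ℕ → (Index d → ℕ) → Set
ShapeInΔ {d} m π = ∀ (v : Index d) → 0 < π v → InΔ m v

-- π is a d-dimensional partition with sh(π) ⊆ Δ_{d-1}(m)
-- (finiteness of the support follows from sh(π) ⊆ Δ_{d-1}(m)).
PartitionInΔ : (d m : ℕ) → (Index d → ℕ) → Set
PartitionInΔ d m π = Decreasing π × ShapeInΔ m π

vecsUpTo : (d k : ℕ) → List (Index d)
vecsUpTo zero    k = [] ∷ []
vecsUpTo (suc d) k =
  concatMap (λ x → map (x ∷_) (vecsUpTo d (k ∸ x))) (upTo (suc k))

-- The points of Δ_{d-1}(m) (for m ≥ 1): vsum v ≤ m - 1.
Δpts : (d m : ℕ) → List (Index d)
Δpts d m = vecsUpTo d (m ∸ 1)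

-- Number of corners of D(π) lying above the index v: the number of
-- heights h with 1 ≤ h ≤ π_v such that (v + e_ℓ, h) ∉ D(π) for all ℓ,
-- i.e. π_{v+e_ℓ} < h for all ℓ ∈ [d].
corAt : ∀ {d} → (Index d → ℕ) → Index d → ℕ
corAt {d} π v =
  length (filter (λ h → all? (λ ℓ → π (v +e ℓ) <? h)) (map suc (upTo (π v))))

-- cor(π) and |π|_ch, summing over the finite set Δ_{d-1}(m) which contains
-- sh(π) (all corners lie above sh(π)).
cor : (d m : ℕ) → (Index d → ℕ) → ℕ
cor d m π = sum (map (corAt π) (Δpts d m))

chWeight : (d m : ℕ) → (Index d → ℕ) → ℕ
chWeight d m π = sum (map (λ v → ch v * corAt π v) (Δpts d m))

-- Formal power series in t, q with ℕ coefficients: f a b = [t^a q^b] f.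

Series : Set
Series = ℕ → ℕ → ℕ

one : Series
one zero zero = 1
one _    _    = 0

_⊛_ : Series → Series → Series
(f ⊛ g) a b =
  sum (map (λ i → sum (map (λ j → f i j * g (a ∸ i) (b ∸ j)) (upTo (suc b))))
           (upTo (suc a)))

_^ˢ_ : Series → ℕ → Series
f ^ˢ zero  = one
f ^ˢ suc k = f ⊛ (f ^ˢ k)

-- (1 - t q^n)^{-1} = Σ_k t^k q^{n k}
geomInv : ℕ → Series
geomInv n a b with b ≟ n * a
... | yes _ = 1
... | no  _ = 0

rhs : (d m : ℕ) → Series
rhs d zero    = one
rhs d (suc n) = rhs d n ⊛ (geomInv (suc n) ^ˢ ((suc n + d ∸ 2) C (d ∸ 1)))

-- The coefficient of t^a q^b on the left is the number of partitions π
-- with sh(π) ⊆ Δ_{d-1}(m), cor(π) = a, |π|_ch = b.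

Counted : (d m a b : ℕ) → (Index d → ℕ) → Set
Counted d m a b π = PartitionInΔ d m π × cor d m π ≡ a × chWeight d m π ≡ b

-- "the set {π | P π} has exactly n elements" (functions up to pointwise
-- equality): a duplicate-free exhaustive list of length n.
HasCard : ∀ {d} → ((Index d → ℕ) → Set) → ℕ → Set
HasCard {d} P n =
  Σ (List (Index d → ℕ)) λ L →
    All P L ×
    (∀ π → P π → Any (λ σ → π ≗ σ) L) ×
    AllPairs (λ σ τ → ¬ (σ ≗ τ)) L ×
    length L ≡ n

-- A partition π with sh(π) ⊆ Δ_{d-1}(m) has c_v = π_v − max_ℓ π_{v+e_ℓ} corners above v, and π is
-- recovered from c by π_v = c_v + max_ℓ π_{v+e_ℓ}, working inwards from the boundary of the pyramid;
-- every c : ℤ₊^d → ℕ supported in the pyramid arises this way. Under this bijection cor(π) = Σ_v c_v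
-- and |π|_ch = Σ_v ch(v) c_v, so the generating function is a product of one geometric series
-- 1/(1 − t q^{ch(v)}) per point v of the pyramid. The points with ch(v) = n are the compositions of
-- n − 1 into d nonnegative parts, and there are binom(n+d−2, d−1) of them by Pascal's rule.
module Submission where

open import Defs
open import Data.Bool using (if_then_else_)
open import Data.Fin using (Fin; zero; suc)
open import Data.Fin.Properties using (all?)
open import Data.List using (List; []; _∷_; [_]; map; upTo; concatMap; cartesianProduct; filter; length; _++_)
open import Data.List.Properties
  using (length-map; length-++; map-++; filter-++; filter-accept; filter-reject; upTo-∷ʳ)
open import Data.List.Membership.Propositional using (_∈_; _∉_; find; lose)
open import Data.List.Membership.Propositional.Properties
  using (∈-map⁺; ∈-map⁻; ∈-++⁺ˡ; ∈-++⁺ʳ; ∈-++⁻; ∈-concatMap⁺; ∈-concatMap⁻;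
         ∈-cartesianProduct⁺; ∈-cartesianProduct⁻; ∈-upTo⁺; ∈-upTo⁻)
open import Data.List.Membership.Propositional.Properties.WithK using (unique∧set⇒bag)
open import Data.List.Relation.Binary.BagAndSetEquality using (∼bag⇒↭)
open import Data.List.Relation.Binary.Permutation.Propositional using (_↭_)
import Data.List.Relation.Binary.Permutation.Propositional.Properties as ↭
open import Data.List.Relation.Unary.Any using (here; there)
import Data.List.Relation.Unary.Any as Any
import Data.List.Relation.Unary.Any.Properties as Any
import Data.List.Relation.Unary.All as All
import Data.List.Relation.Unary.All.Properties as All
import Data.List.Relation.Unary.AllPairs as AllPairs
import Data.List.Relation.Unary.AllPairs.Properties as AllPairs
open import Data.List.Relation.Unary.Unique.Propositional using (Unique)
import Data.List.Relation.Unary.Unique.Propositional.Properties as Unique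
open import Data.Nat using (ℕ; zero; suc; pred; _+_; _*_; _∸_; _≤_; _<_; _⊔_; _≤?_; _<?_; z≤n; s≤s; s≤s⁻¹)
open import Data.Nat.Combinatorics using (_C_; nCn≡1; nCk≡nC[n∸k]; nCk+nC[k+1]≡[n+1]C[k+1])
open import Data.Nat.ListAction using (sum)
open import Data.Nat.ListAction.Properties using (sum-++; sum-↭)
open import Data.Nat.Properties
open import Data.Product using (Σ; ∃; _×_; _,_; proj₁; proj₂; uncurry)
open import Data.Sum using (inj₁; inj₂)
open import Data.Unit using (⊤; tt)
open import Data.Vec using (Vec; []; _∷_)
import Data.Vec as Vec
import Data.Vec.Properties as Vecₚ
open import Function using (_∘_; id; const)
open import Function.Bundles using (Inverse; _↔_; mk↔ₛ′; Equivalence; _⇔_; mk⇔)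
open import Relation.Binary using (DecidableEquality)
open import Relation.Binary.PropositionalEquality hiding ([_])
open import Relation.Nullary using (¬_; yes; no; does; contradiction)
open import Relation.Unary using (Decidable)

private
  variable
    A B : Set

length-concatMap : (F : A → List B) (xs : List A) →
                   length (concatMap F xs) ≡ sum (map (length ∘ F) xs)
length-concatMap F []       = refl
length-concatMap F (x ∷ xs) =
  trans (length-++ (F x)) (cong (length (F x) +_) (length-concatMap F xs))

length-cartesianProduct : (xs : List A) (ys : List B) →
                          length (cartesianProduct xs ys) ≡ length xs * length ys
length-cartesianProduct []       ys = refl
length-cartesianProduct (x ∷ xs) ys =
  trans (length-++ (map (x ,_) ys))
        (cong₂ _+_ (length-map (x ,_) ys) (length-cartesianProduct xs ys))

Unique-concatMap⁺ : (F : A → List B) (label : B → A) {xs : List A} → Unique xs →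
                    (∀ x → Unique (F x)) → (∀ x {y} → y ∈ F x → label y ≡ x) →
                    Unique (concatMap F xs)
Unique-concatMap⁺ F label xs! F! labelled =
  Unique.concat⁺ (All.map⁺ (All.universal F! _))
    (AllPairs.map⁺ (AllPairs.map disjoint xs!))
  where
  disjoint : ∀ {x x′} → x ≢ x′ → ∀ {y} → ¬ (y ∈ F x × y ∈ F x′)
  disjoint x≢x′ (y∈ , y∈′) = x≢x′ (trans (sym (labelled _ y∈)) (labelled _ y∈′))

sum-map-*ˡ : ∀ (w : ℕ) (c : A → ℕ) xs → sum (map (λ x → w * c x) xs) ≡ w * sum (map c xs)
sum-map-*ˡ w c []       = sym (*-zeroʳ w)
sum-map-*ˡ w c (x ∷ xs) = trans (cong (w * c x +_) (sum-map-*ˡ w c xs)) (sym (*-distribˡ-+ w (c x) _))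

sum-map-++ : ∀ (f : A → ℕ) xs ys → sum (map f (xs ++ ys)) ≡ sum (map f xs) + sum (map f ys)
sum-map-++ f xs ys = trans (cong sum (map-++ f xs ys)) (sum-++ (map f xs) (map f ys))

sum-map-cong-on : ∀ {f g : A → ℕ} xs → (∀ {x} → x ∈ xs → f x ≡ g x) → sum (map f xs) ≡ sum (map g xs)
sum-map-cong-on []       f≡g = refl
sum-map-cong-on (x ∷ xs) f≡g = cong₂ _+_ (f≡g (here refl)) (sum-map-cong-on xs (f≡g ∘ there))

filter-≐-on : ∀ {P Q : A → Set} (P? : Decidable P) (Q? : Decidable Q) {xs} →
              All.All (λ x → P x ⇔ Q x) xs → filter P? xs ≡ filter Q? xs
filter-≐-on P? Q? All.[] = refl
filter-≐-on P? Q? {x ∷ xs} (P⇔Q All.∷ rest) with P? x | Q? x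
... | yes _  | yes _  = cong (x ∷_) (filter-≐-on P? Q? rest)
... | no  _  | no  _  = filter-≐-on P? Q? rest
... | yes Px | no ¬Qx = contradiction (Equivalence.to P⇔Q Px) ¬Qx
... | no ¬Px | yes Qx = contradiction (Equivalence.from P⇔Q Qx) ¬Px

module FunctionsOnList {A : Set} (_≟ᴬ_ : DecidableEquality A) where

  tabulateOn : (L : List A) → (A → ℕ) → Vec ℕ (length L)
  tabulateOn []      c = []
  tabulateOn (x ∷ L) c = c x ∷ tabulateOn L c

  lookupOn : (L : List A) → Vec ℕ (length L) → A → ℕ
  lookupOn []      []       y = 0
  lookupOn (x ∷ L) (n ∷ ns) y = if does (x ≟ᴬ y) then n else lookupOn L ns y

  lookupOn-∉ : ∀ L ns {y} → y ∉ L → lookupOn L ns y ≡ 0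
  lookupOn-∉ []      []       y∉ = refl
  lookupOn-∉ (x ∷ L) (n ∷ ns) {y} y∉ with x ≟ᴬ y
  ... | yes refl = contradiction (here refl) y∉
  ... | no  _    = lookupOn-∉ L ns (y∉ ∘ there)

  lookupOn-tabulateOn : ∀ L c {y} → y ∈ L → lookupOn L (tabulateOn L c) y ≡ c y
  lookupOn-tabulateOn (x ∷ L) c {y} y∈ with x ≟ᴬ y | y∈
  ... | yes refl | _          = refl
  ... | no  x≢y  | here y≡x   = contradiction (sym y≡x) x≢y
  ... | no  _    | there y∈L  = lookupOn-tabulateOn L c y∈L

  tabulateOn-cong : ∀ L {c c′ : A → ℕ} → (∀ {y} → y ∈ L → c y ≡ c′ y) → tabulateOn L c ≡ tabulateOn L c′
  tabulateOn-cong []      c≡c′ = refl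
  tabulateOn-cong (x ∷ L) c≡c′ = cong₂ _∷_ (c≡c′ (here refl)) (tabulateOn-cong L (c≡c′ ∘ there))

  tabulateOn-lookupOn : ∀ {L} ns → Unique L → tabulateOn L (lookupOn L ns) ≡ ns
  tabulateOn-lookupOn {[]}    []       _             = refl
  tabulateOn-lookupOn {x ∷ L} (n ∷ ns) (x∉L AllPairs.∷ L!) = cong₂ _∷_ head-entry
    (trans (tabulateOn-cong L skip-head) (tabulateOn-lookupOn ns L!))
    where
    head-entry : lookupOn (x ∷ L) (n ∷ ns) x ≡ n
    head-entry with x ≟ᴬ x
    ... | yes _   = refl
    ... | no  x≢x = contradiction refl x≢x
    skip-head : ∀ {y} → y ∈ L → lookupOn (x ∷ L) (n ∷ ns) y ≡ lookupOn L ns y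
    skip-head {y} y∈L with x ≟ᴬ y
    ... | yes refl = contradiction y∈L (All.All¬⇒¬Any x∉L)
    ... | no  _    = refl

  sum-tabulateOn : ∀ L c → Vec.sum (tabulateOn L c) ≡ sum (map c L)
  sum-tabulateOn []      c = refl
  sum-tabulateOn (x ∷ L) c = cong (c x +_) (sum-tabulateOn L c)

record GeneratingFunction (A : Set) (s t : A → ℕ) (f : Series) : Set where
  field
    enum        : ℕ → ℕ → List A
    sound       : ∀ {a b x} → x ∈ enum a b → s x ≡ a × t x ≡ b
    complete    : ∀ {a b} x → s x ≡ a → t x ≡ b → x ∈ enum a b
    unique      : ∀ a b → Unique (enum a b)
    length-enum : ∀ a b → length (enum a b) ≡ f a b

open GeneratingFunction

gf-one : GeneratingFunction ⊤ (const 0) (const 0) one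
gf-one = record
  { enum = enum′ ; sound = sound′ ; complete = complete′ ; unique = unique′ ; length-enum = length′ }
  where
  enum′ : ℕ → ℕ → List ⊤
  enum′ zero zero = tt ∷ []
  enum′ _    _    = []
  sound′ : ∀ {a b x} → x ∈ enum′ a b → 0 ≡ a × 0 ≡ b
  sound′ {zero} {zero} _ = refl , refl
  complete′ : ∀ {a b} x → 0 ≡ a → 0 ≡ b → x ∈ enum′ a b
  complete′ tt refl refl = here refl
  unique′ : ∀ a b → Unique (enum′ a b)
  unique′ zero    zero    = All.[] AllPairs.∷ AllPairs.[]
  unique′ zero    (suc b) = AllPairs.[]
  unique′ (suc a) b       = AllPairs.[]
  length′ : ∀ a b → length (enum′ a b) ≡ one a b
  length′ zero    zero    = refl
  length′ zero    (suc b) = refl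
  length′ (suc a) b       = refl

gf-geomInv : (w : ℕ) → GeneratingFunction ℕ id (w *_) (geomInv w)
gf-geomInv w = record
  { enum = enum′ ; sound = sound′ ; complete = complete′ ; unique = unique′ ; length-enum = length′ }
  where
  enum′ : ℕ → ℕ → List ℕ
  enum′ a b with b ≟ w * a
  ... | yes _ = a ∷ []
  ... | no  _ = []
  sound′ : ∀ {a b x} → x ∈ enum′ a b → x ≡ a × w * x ≡ b
  sound′ {a} {b} x∈ with b ≟ w * a | x∈
  ... | yes b≡wa | here refl = refl , sym b≡wa
  complete′ : ∀ {a b} x → x ≡ a → w * x ≡ b → x ∈ enum′ a b
  complete′ {a} {b} x refl refl with b ≟ w * a
  ... | yes _    = here refl
  ... | no  b≢wa = contradiction refl b≢wa
  unique′ : ∀ a b → Unique (enum′ a b)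
  unique′ a b with b ≟ w * a
  ... | yes _ = All.[] AllPairs.∷ AllPairs.[]
  ... | no  _ = AllPairs.[]
  length′ : ∀ a b → length (enum′ a b) ≡ geomInv w a b
  length′ a b with b ≟ w * a
  ... | yes _ = refl
  ... | no  _ = refl

gf-↔ : ∀ {s t f} {s′ t′ : B → ℕ} (e : A ↔ B) →
       let open Inverse e in s′ ∘ to ≗ s → t′ ∘ to ≗ t →
       GeneratingFunction A s t f → GeneratingFunction B s′ t′ f
gf-↔ {B = B} {s = s} {t = t} {f = f} {s′ = s′} {t′ = t′} e s′∘to t′∘to G = record
  { enum = enum′ ; sound = sound′ ; complete = complete′ ; unique = unique′ ; length-enum = length′ }
  where
  open Inverse e
  enum′ : ℕ → ℕ → List B
  enum′ a b = map to (enum G a b)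
  sound′ : ∀ {a b y} → y ∈ enum′ a b → s′ y ≡ a × t′ y ≡ b
  sound′ y∈ with x , x∈ , refl ← ∈-map⁻ to y∈ =
    trans (s′∘to x) (proj₁ (sound G x∈)) , trans (t′∘to x) (proj₂ (sound G x∈))
  complete′ : ∀ {a b} y → s′ y ≡ a → t′ y ≡ b → y ∈ enum′ a b
  complete′ {a} {b} y refl refl =
    subst (_∈ enum′ a b) (strictlyInverseˡ y) (∈-map⁺ to (complete G (from y)
      (trans (sym (s′∘to (from y))) (cong s′ (strictlyInverseˡ y)))
      (trans (sym (t′∘to (from y))) (cong t′ (strictlyInverseˡ y)))))
  unique′ : ∀ a b → Unique (enum′ a b)
  unique′ a b = Unique.map⁺ to-injective (unique G a b)
    where
    to-injective : ∀ {x x′} → to x ≡ to x′ → x ≡ x′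
    to-injective {x} {x′} e = trans (sym (strictlyInverseʳ x)) (trans (cong from e) (strictlyInverseʳ x′))
  length′ : ∀ a b → length (enum′ a b) ≡ f a b
  length′ a b = trans (length-map to (enum G a b)) (length-enum G a b)

gf-⊛ : ∀ {sA tA : A → ℕ} {sB tB : B → ℕ} {f g} →
       GeneratingFunction A sA tA f → GeneratingFunction B sB tB g →
       GeneratingFunction (A × B) (λ (x , y) → sA x + sB y) (λ (x , y) → tA x + tB y) (f ⊛ g)
gf-⊛ {A = A} {B} {sA} {tA} {sB} {tB} {f} {g} F G = record
  { enum = enum′ ; sound = sound′ ; complete = complete′ ; unique = unique′ ; length-enum = length′ }
  where
  block : ℕ → ℕ → ℕ → ℕ → List (A × B)
  block a b i j = cartesianProduct (enum F i j) (enum G (a ∸ i) (b ∸ j))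
  row : ℕ → ℕ → ℕ → List (A × B)
  row a b i = concatMap (block a b i) (upTo (suc b))
  enum′ : ℕ → ℕ → List (A × B)
  enum′ a b = concatMap (row a b) (upTo (suc a))

  ∈-block⁻ : ∀ {a b i j x y} → (x , y) ∈ block a b i j →
             (sA x ≡ i × tA x ≡ j) × (sB y ≡ a ∸ i × tB y ≡ b ∸ j)
  ∈-block⁻ {i = i} {j} p∈ with x∈ , y∈ ← ∈-cartesianProduct⁻ (enum F i j) _ p∈ =
    sound F x∈ , sound G y∈

  ∈-row⁻ : ∀ {a b i p} → p ∈ row a b i →
           ∃ λ j → j ≤ b × p ∈ block a b i j
  ∈-row⁻ p∈ with j , j∈ , p∈′ ← find (∈-concatMap⁻ _ p∈) = j , s≤s⁻¹ (∈-upTo⁻ j∈) , p∈′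

  ∈-enum⁻ : ∀ {a b p} → p ∈ enum′ a b →
            ∃ λ i → i ≤ a × ∃ λ j → j ≤ b × p ∈ block a b i j
  ∈-enum⁻ p∈ with i , i∈ , p∈′ ← find (∈-concatMap⁻ _ p∈) = i , s≤s⁻¹ (∈-upTo⁻ i∈) , ∈-row⁻ p∈′

  sound′ : ∀ {a b p} → p ∈ enum′ a b → sA (proj₁ p) + sB (proj₂ p) ≡ a × tA (proj₁ p) + tB (proj₂ p) ≡ b
  sound′ p∈ =
    let i , i≤a , j , j≤b , p∈′ = ∈-enum⁻ p∈
        (sx , tx) , (sy , ty)   = ∈-block⁻ p∈′
    in trans (cong₂ _+_ sx sy) (m+[n∸m]≡n i≤a) , trans (cong₂ _+_ tx ty) (m+[n∸m]≡n j≤b)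

  complete′ : ∀ {a b} p → sA (proj₁ p) + sB (proj₂ p) ≡ a → tA (proj₁ p) + tB (proj₂ p) ≡ b → p ∈ enum′ a b
  complete′ (x , y) refl refl =
    ∈-concatMap⁺ (row _ _) (lose (∈-upTo⁺ (s≤s (m≤m+n (sA x) (sB y))))
      (∈-concatMap⁺ (block _ _ _) (lose (∈-upTo⁺ (s≤s (m≤m+n (tA x) (tB y))))
        (∈-cartesianProduct⁺ (complete F x refl refl)
          (complete G y (sym (m+n∸m≡n (sA x) (sB y))) (sym (m+n∸m≡n (tA x) (tB y))))))))

  unique′ : ∀ a b → Unique (enum′ a b)
  unique′ a b =
    Unique-concatMap⁺ (row a b) (sA ∘ proj₁) (Unique.upTo⁺ (suc a)) row-unique
      (λ i p∈ → let _ , _ , p∈′ = ∈-row⁻ p∈ in proj₁ (proj₁ (∈-block⁻ p∈′)))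
    where
    row-unique : ∀ i → Unique (row a b i)
    row-unique i =
      Unique-concatMap⁺ (block a b i) (tA ∘ proj₁) (Unique.upTo⁺ (suc b))
        (λ j → Unique.cartesianProduct⁺ (unique F i j) (unique G (a ∸ i) (b ∸ j)))
        (λ j p∈ → proj₂ (proj₁ (∈-block⁻ p∈)))

  length′ : ∀ a b → length (enum′ a b) ≡ (f ⊛ g) a b
  length′ a b = begin
    length (enum′ a b)
      ≡⟨ length-concatMap (row a b) (upTo (suc a)) ⟩
    sum (map (length ∘ row a b) (upTo (suc a)))
      ≡⟨ sum-map-cong-on (upTo (suc a)) (λ {i} _ → length-concatMap (block a b i) (upTo (suc b))) ⟩
    sum (map (λ i → sum (map (length ∘ block a b i) (upTo (suc b)))) (upTo (suc a)))
      ≡⟨ sum-map-cong-on (upTo (suc a)) (λ {i} _ → sum-map-cong-on (upTo (suc b)) (λ {j} _ → length-block i j)) ⟩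
    (f ⊛ g) a b ∎
    where
    open ≡-Reasoning
    length-block : ∀ i j → length (block a b i j) ≡ f i j * g (a ∸ i) (b ∸ j)
    length-block i j = trans (length-cartesianProduct (enum F i j) (enum G (a ∸ i) (b ∸ j)))
                             (cong₂ _*_ (length-enum F i j) (length-enum G (a ∸ i) (b ∸ j)))

gf-Vec : (w k : ℕ) → GeneratingFunction (Vec ℕ k) Vec.sum (λ xs → w * Vec.sum xs) (geomInv w ^ˢ k)
gf-Vec w zero =
  gf-↔ (mk↔ₛ′ (const []) (const tt) (λ { [] → refl }) (λ _ → refl))
       (λ _ → refl) (λ _ → *-zeroʳ w) gf-one
gf-Vec w (suc k) =
  gf-↔ (mk↔ₛ′ (uncurry _∷_) (λ { (x ∷ xs) → x , xs }) (λ { (x ∷ xs) → refl }) (λ _ → refl))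
       (λ _ → refl) (λ (x , xs) → *-distribˡ-+ w x (Vec.sum xs))
       (gf-⊛ (gf-geomInv w) (gf-Vec w k))

hasCard-image : ∀ {d} {T : Set} {s t : T → ℕ} {f} (P : ℕ → ℕ → (Index d → ℕ) → Set) →
                GeneratingFunction T s t f → (Ψ : T → Index d → ℕ) →
                (∀ x → P (s x) (t x) (Ψ x)) →
                (∀ {a b} π → P a b π → Σ T λ x → s x ≡ a × t x ≡ b × π ≗ Ψ x) →
                (∀ x y → Ψ x ≗ Ψ y → x ≡ y) →
                ∀ a b → HasCard (P a b) (f a b)
hasCard-image P G Ψ P-image P-preimage Ψ-injective a b =
  map Ψ (enum G a b) , all-P , preimage-listed , distinct , trans (length-map Ψ (enum G a b)) (length-enum G a b)
  where
  all-P : All.All (P a b) (map Ψ (enum G a b))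
  all-P = All.map⁺ (All.tabulate λ {x} x∈ →
    let s≡a , t≡b = sound G x∈ in subst₂ (λ a b → P a b (Ψ x)) s≡a t≡b (P-image x))
  preimage-listed : ∀ π → P a b π → Any.Any (π ≗_) (map Ψ (enum G a b))
  preimage-listed π Pπ =
    let x , s≡a , t≡b , π≗Ψx = P-preimage π Pπ
    in Any.map⁺ (Any.map (λ { refl → π≗Ψx }) (complete G x s≡a t≡b))
  distinct : AllPairs.AllPairs (λ σ τ → ¬ σ ≗ τ) (map Ψ (enum G a b))
  distinct = AllPairs.map⁺ (AllPairs.map (λ x≢y Ψx≗Ψy → x≢y (Ψ-injective _ _ Ψx≗Ψy)) (unique G a b))

incHead : ∀ {d} → Index (suc d) → Index (suc d)
incHead (x ∷ v) = suc x ∷ v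

layer : (d n : ℕ) → List (Index d)
layer zero    zero    = [] ∷ []
layer zero    (suc n) = []
layer (suc d) zero    = map (0 ∷_) (layer d zero)
layer (suc d) (suc n) = map (0 ∷_) (layer d (suc n)) ++ map incHead (layer (suc d) n)

∈-layer⁻ : ∀ d n {v} → v ∈ layer d n → vsum v ≡ n
∈-layer⁻ zero    zero    (here refl) = refl
∈-layer⁻ (suc d) zero    v∈ with w , w∈ , refl ← ∈-map⁻ (0 ∷_) v∈ = ∈-layer⁻ d zero w∈
∈-layer⁻ (suc d) (suc n) v∈ with ∈-++⁻ (map (0 ∷_) (layer d (suc n))) v∈
... | inj₁ v∈′ with w , w∈ , refl ← ∈-map⁻ (0 ∷_) v∈′ = ∈-layer⁻ d (suc n) w∈
... | inj₂ v∈′ with x ∷ w , w∈ , refl ← ∈-map⁻ incHead v∈′ = cong suc (∈-layer⁻ (suc d) n w∈)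

∈-layer⁺ : ∀ {d} n (v : Index d) → vsum v ≡ n → v ∈ layer d n
∈-layer⁺ zero    []           refl = here refl
∈-layer⁺ zero    (zero ∷ w)   s≡0  = ∈-map⁺ (0 ∷_) (∈-layer⁺ zero w s≡0)
∈-layer⁺ (suc n) (zero ∷ w)   s≡n  = ∈-++⁺ˡ (∈-map⁺ (0 ∷_) (∈-layer⁺ (suc n) w s≡n))
∈-layer⁺ {suc d} (suc n) (suc x ∷ w) s≡n =
  ∈-++⁺ʳ (map (0 ∷_) (layer d (suc n))) (∈-map⁺ incHead (∈-layer⁺ n (x ∷ w) (suc-injective s≡n)))

layer-unique : ∀ d n → Unique (layer d n)
layer-unique zero    zero    = All.[] AllPairs.∷ AllPairs.[]
layer-unique zero    (suc n) = AllPairs.[]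
layer-unique (suc d) zero    = Unique.map⁺ Vecₚ.∷-injectiveʳ (layer-unique d zero)
layer-unique (suc d) (suc n) =
  Unique.++⁺ (Unique.map⁺ Vecₚ.∷-injectiveʳ (layer-unique d (suc n)))
             (Unique.map⁺ incHead-injective (layer-unique (suc d) n))
             heads-differ
  where
  incHead-injective : ∀ {v w : Index (suc d)} → incHead v ≡ incHead w → v ≡ w
  incHead-injective {_ ∷ _} {_ ∷ _} refl = refl
  heads-differ : ∀ {v} → ¬ (v ∈ map (0 ∷_) (layer d (suc n)) × v ∈ map incHead (layer (suc d) n))
  heads-differ (v∈ , v∈′) with _ , _ , refl ← ∈-map⁻ (0 ∷_) v∈ | _ ∷ _ , _ , () ← ∈-map⁻ incHead v∈′

length-layer : ∀ d n → length (layer (suc d) n) ≡ (n + d) C d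
length-layer zero zero = refl
length-layer zero (suc n) = begin
  length (map incHead (layer 1 n)) ≡⟨ length-map incHead (layer 1 n) ⟩
  length (layer 1 n)               ≡⟨ length-layer zero n ⟩
  (n + 0) C 0                      ≡⟨ nC0≡1 (n + 0) ⟩
  1                                ≡⟨ nC0≡1 (suc n + 0) ⟨
  (suc n + 0) C 0                  ∎
  where
  open ≡-Reasoning
  nC0≡1 : ∀ k → k C 0 ≡ 1
  nC0≡1 k = trans (nCk≡nC[n∸k] {0} {k} z≤n) (nCn≡1 k)
length-layer (suc d) zero =
  trans (length-map (0 ∷_) (layer (suc d) zero))
        (trans (length-layer d zero) (trans (nCn≡1 d) (sym (nCn≡1 (suc d)))))
length-layer (suc d) (suc n) = begin
  length (map (0 ∷_) (layer (suc d) (suc n)) ++ map incHead (layer (suc (suc d)) n))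
    ≡⟨ length-++ (map (0 ∷_) (layer (suc d) (suc n))) ⟩
  length (map (0 ∷_) (layer (suc d) (suc n))) + length (map incHead (layer (suc (suc d)) n))
    ≡⟨ cong₂ _+_ (length-map (0 ∷_) (layer (suc d) (suc n))) (length-map incHead (layer (suc (suc d)) n)) ⟩
  length (layer (suc d) (suc n)) + length (layer (suc (suc d)) n)
    ≡⟨ cong₂ _+_ (length-layer d (suc n)) (length-layer (suc d) n) ⟩
  (suc n + d) C d + (n + suc d) C suc d
    ≡⟨ cong (λ k → k C d + (n + suc d) C suc d) (sym (+-suc n d)) ⟩
  (n + suc d) C d + (n + suc d) C suc d
    ≡⟨ nCk+nC[k+1]≡[n+1]C[k+1] (n + suc d) d ⟩
  suc (n + suc d) C suc d ∎
  where open ≡-Reasoning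

∈-vecsUpTo⁻ : ∀ d k {v} → v ∈ vecsUpTo d k → vsum v ≤ k
∈-vecsUpTo⁻ zero    k (here refl) = z≤n
∈-vecsUpTo⁻ (suc d) k v∈
  with x , x∈ , v∈′ ← find (∈-concatMap⁻ (λ x → map (x ∷_) (vecsUpTo d (k ∸ x))) {upTo (suc k)} v∈)
  with w , w∈ , refl ← ∈-map⁻ (x ∷_) v∈′ =
  ≤-trans (+-monoʳ-≤ x (∈-vecsUpTo⁻ d (k ∸ x) w∈)) (≤-reflexive (m+[n∸m]≡n (s≤s⁻¹ (∈-upTo⁻ x∈))))

∈-vecsUpTo⁺ : ∀ d k (v : Index d) → vsum v ≤ k → v ∈ vecsUpTo d k
∈-vecsUpTo⁺ zero    k []      _ = here refl
∈-vecsUpTo⁺ (suc d) k (x ∷ w) s≤k =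
  ∈-concatMap⁺ (λ x → map (x ∷_) (vecsUpTo d (k ∸ x)))
    (lose (∈-upTo⁺ (s≤s (m+n≤o⇒m≤o x s≤k)))
          (∈-map⁺ (x ∷_) (∈-vecsUpTo⁺ d (k ∸ x) w (m+n≤o⇒m≤o∸n (vsum w) (subst (_≤ k) (+-comm x (vsum w)) s≤k)))))

vecsUpTo-unique : ∀ d k → Unique (vecsUpTo d k)
vecsUpTo-unique zero    k = All.[] AllPairs.∷ AllPairs.[]
vecsUpTo-unique (suc d) k =
  Unique-concatMap⁺ (λ x → map (x ∷_) (vecsUpTo d (k ∸ x))) Vec.head (Unique.upTo⁺ (suc k))
    (λ x → Unique.map⁺ Vecₚ.∷-injectiveʳ (vecsUpTo-unique d (k ∸ x)))
    head-label
  where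
  head-label : ∀ x {v} → v ∈ map (x ∷_) (vecsUpTo d (k ∸ x)) → Vec.head v ≡ x
  head-label x v∈ with _ , _ , refl ← ∈-map⁻ (x ∷_) v∈ = refl

layersBelow : (d n : ℕ) → List (Index d)
layersBelow d zero    = []
layersBelow d (suc n) = layersBelow d n ++ layer d n

∈-layersBelow⁻ : ∀ d n {v} → v ∈ layersBelow d n → vsum v < n
∈-layersBelow⁻ d (suc n) v∈ with ∈-++⁻ (layersBelow d n) v∈
... | inj₁ v∈′ = m<n⇒m<1+n (∈-layersBelow⁻ d n v∈′)
... | inj₂ v∈′ = s≤s (≤-reflexive (∈-layer⁻ d n v∈′))

∈-layersBelow⁺ : ∀ d n (v : Index d) → vsum v < n → v ∈ layersBelow d n
∈-layersBelow⁺ d (suc n) v s<1+n with m≤n⇒m<n∨m≡n (s≤s⁻¹ s<1+n)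
... | inj₁ s<n = ∈-++⁺ˡ (∈-layersBelow⁺ d n v s<n)
... | inj₂ s≡n = ∈-++⁺ʳ (layersBelow d n) (∈-layer⁺ n v s≡n)

layersBelow-unique : ∀ d n → Unique (layersBelow d n)
layersBelow-unique d zero    = AllPairs.[]
layersBelow-unique d (suc n) =
  Unique.++⁺ (layersBelow-unique d n) (layer-unique d n)
    (λ (v∈ , v∈′) → <-irrefl (∈-layer⁻ d n v∈′) (∈-layersBelow⁻ d n v∈))

vecsUpTo↭layersBelow : ∀ d k → vecsUpTo d k ↭ layersBelow d (suc k)
vecsUpTo↭layersBelow d k =
  ∼bag⇒↭ (unique∧set⇒bag (vecsUpTo-unique d k) (layersBelow-unique d (suc k))
    (mk⇔ (λ v∈ → ∈-layersBelow⁺ d (suc k) _ (s≤s (∈-vecsUpTo⁻ d k v∈)))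
         (λ v∈ → ∈-vecsUpTo⁺ d k _ (s≤s⁻¹ (∈-layersBelow⁻ d (suc k) v∈)))))

length-filter->-map-suc-upTo : ∀ M n → length (filter (M <?_) (map suc (upTo n))) ≡ n ∸ M
length-filter->-map-suc-upTo M zero    = sym (0∸n≡0 M)
length-filter->-map-suc-upTo M (suc n) = begin
  length (filter (M <?_) (map suc (upTo (suc n))))
    ≡⟨ cong (length ∘ filter (M <?_)) (trans (cong (map suc) (sym (upTo-∷ʳ n))) (map-++ suc (upTo n) [ n ])) ⟩
  length (filter (M <?_) (map suc (upTo n) ++ [ suc n ]))
    ≡⟨ cong length (filter-++ (M <?_) (map suc (upTo n)) [ suc n ]) ⟩
  length (filter (M <?_) (map suc (upTo n)) ++ filter (M <?_) [ suc n ])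
    ≡⟨ length-++ (filter (M <?_) (map suc (upTo n))) ⟩
  length (filter (M <?_) (map suc (upTo n))) + length (filter (M <?_) [ suc n ])
    ≡⟨ cong (_+ length (filter (M <?_) [ suc n ])) (length-filter->-map-suc-upTo M n) ⟩
  n ∸ M + length (filter (M <?_) [ suc n ])
    ≡⟨ last-step ⟩
  suc n ∸ M ∎
  where
  open ≡-Reasoning
  last-step : n ∸ M + length (filter (M <?_) [ suc n ]) ≡ suc n ∸ M
  last-step with M ≤? n
  ... | yes M≤n = begin
    n ∸ M + length (filter (M <?_) [ suc n ]) ≡⟨ cong (λ xs → n ∸ M + length xs) (filter-accept (M <?_) (s≤s M≤n)) ⟩
    n ∸ M + 1                                 ≡⟨ +-comm (n ∸ M) 1 ⟩
    suc (n ∸ M)                               ≡⟨ +-∸-assoc 1 M≤n ⟨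
    suc n ∸ M                                 ∎
  ... | no  M≰n = begin
    n ∸ M + length (filter (M <?_) [ suc n ]) ≡⟨ cong (λ xs → n ∸ M + length xs) (filter-reject (M <?_) (M≰n ∘ s≤s⁻¹)) ⟩
    n ∸ M + 0                                 ≡⟨ +-identityʳ (n ∸ M) ⟩
    n ∸ M                                     ≡⟨ m≤n⇒m∸n≡0 (<⇒≤ (≰⇒> M≰n)) ⟩
    0                                         ≡⟨ m≤n⇒m∸n≡0 (≰⇒> M≰n) ⟨
    suc n ∸ M                                 ∎

⨆ : ∀ {k} → (Fin k → ℕ) → ℕ
⨆ {zero}  f = 0
⨆ {suc k} f = f zero ⊔ ⨆ (f ∘ suc)

≤-⨆ : ∀ {k} (f : Fin k → ℕ) ℓ → f ℓ ≤ ⨆ f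
≤-⨆ f zero    = m≤m⊔n _ _
≤-⨆ f (suc ℓ) = ≤-trans (≤-⨆ (f ∘ suc) ℓ) (m≤n⊔m _ _)

⨆-least : ∀ {k} (f : Fin k → ℕ) {n} → (∀ ℓ → f ℓ ≤ n) → ⨆ f ≤ n
⨆-least {zero}  f f≤n = z≤n
⨆-least {suc k} f f≤n = ⊔-lub (f≤n zero) (⨆-least (f ∘ suc) (f≤n ∘ suc))

⨆-cong : ∀ {k} {f g : Fin k → ℕ} → f ≗ g → ⨆ f ≡ ⨆ g
⨆-cong {zero}  f≗g = refl
⨆-cong {suc k} f≗g = cong₂ _⊔_ (f≗g zero) (⨆-cong (f≗g ∘ suc))

neighbourMax : ∀ {d} → (Index d → ℕ) → Index d → ℕ
neighbourMax π v = ⨆ λ ℓ → π (v +e ℓ)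

corAt≡∸neighbourMax : ∀ {d} (π : Index d → ℕ) v → corAt π v ≡ π v ∸ neighbourMax π v
corAt≡∸neighbourMax π v = begin
  length (filter (λ h → all? (λ ℓ → π (v +e ℓ) <? h)) (map suc (upTo (π v))))
    ≡⟨ cong length (filter-≐-on (λ h → all? (λ ℓ → π (v +e ℓ) <? h)) (neighbourMax π v <?_)
                                 (All.map⁺ (All.universal all-below⇔max-below (upTo (π v))))) ⟩
  length (filter (neighbourMax π v <?_) (map suc (upTo (π v))))
    ≡⟨ length-filter->-map-suc-upTo (neighbourMax π v) (π v) ⟩
  π v ∸ neighbourMax π v ∎
  where
  open ≡-Reasoning
  all-below⇔max-below : ∀ h → (∀ ℓ → π (v +e ℓ) < suc h) ⇔ neighbourMax π v < suc h
  all-below⇔max-below h =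
    mk⇔ (λ below → s≤s (⨆-least _ (s≤s⁻¹ ∘ below)))
        (λ max-below ℓ → ≤-<-trans (≤-⨆ (λ ℓ → π (v +e ℓ)) ℓ) max-below)

corAt-cong : ∀ {d} {π σ : Index d → ℕ} → π ≗ σ → corAt π ≗ corAt σ
corAt-cong {π = π} {σ} π≗σ v = begin
  corAt π v                  ≡⟨ corAt≡∸neighbourMax π v ⟩
  π v ∸ neighbourMax π v     ≡⟨ cong₂ _∸_ (π≗σ v) (⨆-cong (π≗σ ∘ (v +e_))) ⟩
  σ v ∸ neighbourMax σ v     ≡⟨ corAt≡∸neighbourMax σ v ⟨
  corAt σ v                  ∎
  where open ≡-Reasoning

vsum-+e : ∀ {d} (v : Index d) ℓ → vsum (v +e ℓ) ≡ suc (vsum v)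
vsum-+e (x ∷ v) zero    = refl
vsum-+e (x ∷ v) (suc ℓ) = trans (cong (x +_) (vsum-+e v ℓ)) (+-suc x (vsum v))

stack : ∀ {d} → (Index d → ℕ) → ℕ → Index d → ℕ
stack c zero    v = 0
stack c (suc k) v = c v + ⨆ (λ ℓ → stack c k (v +e ℓ))

-- π_v = c_v + max_ℓ π_{v+e_ℓ} unrolled m ∸ vsum v times, after which the argument has left the pyramid.
fromCorners : ∀ {d} → ℕ → (Index d → ℕ) → Index d → ℕ
fromCorners m c v = stack c (m ∸ vsum v) v

SupportedBelow : ∀ {d} → ℕ → (Index d → ℕ) → Set
SupportedBelow m c = ∀ v → m ≤ vsum v → c v ≡ 0

module _ {d : ℕ} (m : ℕ) where

  fromCorners-inside : ∀ (c : Index d → ℕ) v → vsum v < m →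
                       fromCorners m c v ≡ c v + neighbourMax (fromCorners m c) v
  fromCorners-inside c v s<m rewrite +-∸-assoc 1 s<m =
    cong (c v +_) (⨆-cong λ ℓ → cong (λ s → stack c (m ∸ s) (v +e ℓ)) (sym (vsum-+e v ℓ)))

  fromCorners-outside : ∀ (c : Index d → ℕ) v → m ≤ vsum v → fromCorners m c v ≡ 0
  fromCorners-outside c v m≤s rewrite m≤n⇒m∸n≡0 m≤s = refl

  fromCorners-partition : ∀ c → PartitionInΔ d m (fromCorners m c)
  fromCorners-partition c = decreasing , shape
    where
    decreasing : Decreasing (fromCorners m c)
    decreasing v ℓ with vsum v <? m
    ... | yes s<m = begin
      fromCorners m c (v +e ℓ)                 ≤⟨ ≤-⨆ (λ ℓ → fromCorners m c (v +e ℓ)) ℓ ⟩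
      neighbourMax (fromCorners m c) v         ≤⟨ m≤n+m _ (c v) ⟩
      c v + neighbourMax (fromCorners m c) v   ≡⟨ fromCorners-inside c v s<m ⟨
      fromCorners m c v                        ∎
      where open ≤-Reasoning
    ... | no s≮m = subst (_≤ fromCorners m c v) (sym (fromCorners-outside c (v +e ℓ) m≤s+1)) z≤n
      where
      m≤s+1 : m ≤ vsum (v +e ℓ)
      m≤s+1 = subst (m ≤_) (sym (vsum-+e v ℓ)) (m≤n⇒m≤1+n (≮⇒≥ s≮m))
    shape : ShapeInΔ m (fromCorners m c)
    shape v 0<π with vsum v <? m
    ... | yes s<m = s<m
    ... | no  s≮m = contradiction (fromCorners-outside c v (≮⇒≥ s≮m)) (≢-sym (<⇒≢ 0<π))

  corAt-fromCorners : ∀ c → SupportedBelow m c → corAt (fromCorners m c) ≗ c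
  corAt-fromCorners c supported v = trans (corAt≡∸neighbourMax (fromCorners m c) v) corners
    where
    M : ℕ
    M = neighbourMax (fromCorners m c) v
    corners : fromCorners m c v ∸ M ≡ c v
    corners with vsum v <? m
    ... | yes s<m = trans (cong (_∸ M) (fromCorners-inside c v s<m)) (m+n∸n≡m (c v) M)
    ... | no  s≮m = begin
      fromCorners m c v ∸ M ≡⟨ cong (_∸ M) (fromCorners-outside c v (≮⇒≥ s≮m)) ⟩
      0 ∸ M                 ≡⟨ 0∸n≡0 M ⟩
      0                     ≡⟨ supported v (≮⇒≥ s≮m) ⟨
      c v                   ∎
      where open ≡-Reasoning

  fromCorners-cong : ∀ {c c′ : Index d → ℕ} → c ≗ c′ → fromCorners m c ≗ fromCorners m c′
  fromCorners-cong {c} {c′} c≗c′ v = stack-cong (m ∸ vsum v) v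
    where
    stack-cong : ∀ k v → stack c k v ≡ stack c′ k v
    stack-cong zero    v = refl
    stack-cong (suc k) v = cong₂ _+_ (c≗c′ v) (⨆-cong λ ℓ → stack-cong k (v +e ℓ))

  module _ {π : Index d → ℕ} (partition : PartitionInΔ d m π) where

    partition-outside : ∀ v → m ≤ vsum v → π v ≡ 0
    partition-outside v m≤s = n≤0⇒n≡0 (≮⇒≥ λ 0<π → <⇒≱ (proj₂ partition v 0<π) m≤s)

    corAt-supported : SupportedBelow m (corAt π)
    corAt-supported v m≤s = begin
      corAt π v              ≡⟨ corAt≡∸neighbourMax π v ⟩
      π v ∸ neighbourMax π v ≡⟨ cong (_∸ neighbourMax π v) (partition-outside v m≤s) ⟩
      0 ∸ neighbourMax π v   ≡⟨ 0∸n≡0 (neighbourMax π v) ⟩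
      0                      ∎
      where open ≡-Reasoning

    stack-corAt : ∀ k v → m ∸ vsum v ≡ k → stack (corAt π) k v ≡ π v
    stack-corAt zero    v m∸s≡0   = sym (partition-outside v (m∸n≡0⇒m≤n m∸s≡0))
    stack-corAt (suc k) v m∸s≡1+k = begin
      corAt π v + ⨆ (λ ℓ → stack (corAt π) k (v +e ℓ)) ≡⟨ cong₂ _+_ (corAt≡∸neighbourMax π v)
                                                             (⨆-cong λ ℓ → stack-corAt k (v +e ℓ) (m∸[v+eℓ]≡k ℓ)) ⟩
      π v ∸ neighbourMax π v + neighbourMax π v          ≡⟨ m∸n+n≡m (⨆-least _ (proj₁ partition v)) ⟩
      π v                                                ∎
      where
      open ≡-Reasoning
      m∸[v+eℓ]≡k : ∀ ℓ → m ∸ vsum (v +e ℓ) ≡ k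
      m∸[v+eℓ]≡k ℓ = begin
        m ∸ vsum (v +e ℓ)    ≡⟨ cong (m ∸_) (vsum-+e v ℓ) ⟩
        m ∸ suc (vsum v)     ≡⟨ pred[m∸n]≡m∸[1+n] m (vsum v) ⟨
        pred (m ∸ vsum v)    ≡⟨ cong pred m∸s≡1+k ⟩
        k                    ∎

    fromCorners-corAt : fromCorners m (corAt π) ≗ π
    fromCorners-corAt v = stack-corAt (m ∸ vsum v) v refl

module LayerTuples (d : ℕ) where

  open FunctionsOnList {Index d} (Vecₚ.≡-dec _≟_)

  LayerTuple : ℕ → Set
  LayerTuple zero    = ⊤
  LayerTuple (suc n) = LayerTuple n × Vec ℕ (length (layer d n))

  tupleCor : ∀ {n} → LayerTuple n → ℕ
  tupleCor {zero}  _        = 0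
  tupleCor {suc n} (x , xs) = tupleCor x + Vec.sum xs

  tupleCh : ∀ {n} → LayerTuple n → ℕ
  tupleCh {zero}  _        = 0
  tupleCh {suc n} (x , xs) = tupleCh x + suc n * Vec.sum xs

  encode : ∀ n → (Index d → ℕ) → LayerTuple n
  encode zero    c = tt
  encode (suc n) c = encode n c , tabulateOn (layer d n) c

  decode : ∀ {n} → LayerTuple n → Index d → ℕ
  decode {zero}  _        v = 0
  decode {suc n} (x , xs) v = decode x v + lookupOn (layer d n) xs v

  decode-outside : ∀ {n} (x : LayerTuple n) v → n ≤ vsum v → decode x v ≡ 0
  decode-outside {zero}  _        v _       = refl
  decode-outside {suc n} (x , xs) v n<s = cong₂ _+_ (decode-outside x v (<⇒≤ n<s))
    (lookupOn-∉ (layer d n) xs (λ v∈ → <-irrefl (sym (∈-layer⁻ d n v∈)) n<s))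

  decode-encode : ∀ n (c : Index d → ℕ) v → vsum v < n → decode (encode n c) v ≡ c v
  decode-encode (suc n) c v s<1+n with m≤n⇒m<n∨m≡n (s≤s⁻¹ s<1+n)
  ... | inj₁ s<n = trans (cong₂ _+_ (decode-encode n c v s<n)
                                   (lookupOn-∉ (layer d n) _ (λ v∈ → <-irrefl (∈-layer⁻ d n v∈) s<n)))
                         (+-identityʳ (c v))
  ... | inj₂ s≡n = cong₂ _+_ (decode-outside (encode n c) v (≤-reflexive (sym s≡n)))
                             (lookupOn-tabulateOn (layer d n) c (∈-layer⁺ n v s≡n))

  encode-cong : ∀ n {c c′ : Index d → ℕ} → (∀ v → vsum v < n → c v ≡ c′ v) → encode n c ≡ encode n c′
  encode-cong zero    c≡c′ = refl
  encode-cong (suc n) c≡c′ = cong₂ _,_ (encode-cong n λ v s<n → c≡c′ v (m<n⇒m<1+n s<n))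
    (tabulateOn-cong (layer d n) λ v∈ → c≡c′ _ (s≤s (≤-reflexive (∈-layer⁻ d n v∈))))

  encode-decode : ∀ {n} (x : LayerTuple n) → encode n (decode x) ≡ x
  encode-decode {zero}  _        = refl
  encode-decode {suc n} (x , xs) = cong₂ _,_
    (trans (encode-cong n λ v s<n → trans (cong (decode x v +_) (lookupOn-∉ (layer d n) xs
              (λ v∈ → <-irrefl (∈-layer⁻ d n v∈) s<n))) (+-identityʳ (decode x v)))
           (encode-decode x))
    (trans (tabulateOn-cong (layer d n) λ {v} v∈ → cong (_+ lookupOn (layer d n) xs v)
              (decode-outside x v (≤-reflexive (sym (∈-layer⁻ d n v∈)))))
           (tabulateOn-lookupOn xs (layer-unique d n)))

  tupleCor-encode : ∀ n (c : Index d → ℕ) → tupleCor (encode n c) ≡ sum (map c (layersBelow d n))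
  tupleCor-encode zero    c = refl
  tupleCor-encode (suc n) c = begin
    tupleCor (encode n c) + Vec.sum (tabulateOn (layer d n) c)
      ≡⟨ cong₂ _+_ (tupleCor-encode n c) (sum-tabulateOn (layer d n) c) ⟩
    sum (map c (layersBelow d n)) + sum (map c (layer d n))
      ≡⟨ sum-map-++ c (layersBelow d n) (layer d n) ⟨
    sum (map c (layersBelow d n ++ layer d n)) ∎
    where open ≡-Reasoning

  tupleCh-encode : ∀ n (c : Index d → ℕ) → tupleCh (encode n c) ≡ sum (map (λ v → ch v * c v) (layersBelow d n))
  tupleCh-encode zero    c = refl
  tupleCh-encode (suc n) c = begin
    tupleCh (encode n c) + suc n * Vec.sum (tabulateOn (layer d n) c)
      ≡⟨ cong₂ _+_ (tupleCh-encode n c) (cong (suc n *_) (sum-tabulateOn (layer d n) c)) ⟩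
    sum (map chc (layersBelow d n)) + suc n * sum (map c (layer d n))
      ≡⟨ cong (sum (map chc (layersBelow d n)) +_) (sum-map-*ˡ (suc n) c (layer d n)) ⟨
    sum (map chc (layersBelow d n)) + sum (map (λ v → suc n * c v) (layer d n))
      ≡⟨ cong (sum (map chc (layersBelow d n)) +_) (sum-map-cong-on (layer d n) λ {v} v∈ →
           cong (λ s → suc s * c v) (∈-layer⁻ d n v∈)) ⟨
    sum (map chc (layersBelow d n)) + sum (map chc (layer d n))
      ≡⟨ sum-map-++ chc (layersBelow d n) (layer d n) ⟨
    sum (map chc (layersBelow d n ++ layer d n)) ∎
    where
    open ≡-Reasoning
    chc : Index d → ℕ
    chc v = ch v * c v

  decode-encode-supported : ∀ n {c : Index d → ℕ} → SupportedBelow n c → decode (encode n c) ≗ c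
  decode-encode-supported n {c} supported v with vsum v <? n
  ... | yes s<n = decode-encode n c v s<n
  ... | no  s≮n = trans (decode-outside (encode n c) v (≮⇒≥ s≮n)) (sym (supported v (≮⇒≥ s≮n)))

  cor≡tupleCor : ∀ k π → cor d (suc k) π ≡ tupleCor (encode (suc k) (corAt π))
  cor≡tupleCor k π = trans (sum-↭ (↭.map⁺ (corAt π) (vecsUpTo↭layersBelow d k)))
                           (sym (tupleCor-encode (suc k) (corAt π)))

  chWeight≡tupleCh : ∀ k π → chWeight d (suc k) π ≡ tupleCh (encode (suc k) (corAt π))
  chWeight≡tupleCh k π = trans (sum-↭ (↭.map⁺ (λ v → ch v * corAt π v) (vecsUpTo↭layersBelow d k)))
                               (sym (tupleCh-encode (suc k) (corAt π)))

  partitionOf : ∀ {m} → LayerTuple m → Index d → ℕ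
  partitionOf {m} x = fromCorners m (decode x)

  encode-corAt-partitionOf : ∀ {m} (x : LayerTuple m) → encode m (corAt (partitionOf x)) ≡ x
  encode-corAt-partitionOf {m} x =
    trans (encode-cong m λ v _ → corAt-fromCorners m (decode x) (decode-outside x) v) (encode-decode x)

  partitionOf-counted : ∀ k (x : LayerTuple (suc k)) → Counted d (suc k) (tupleCor x) (tupleCh x) (partitionOf x)
  partitionOf-counted k x = fromCorners-partition (suc k) (decode x)
    , trans (cor≡tupleCor k (partitionOf x)) (cong tupleCor (encode-corAt-partitionOf x))
    , trans (chWeight≡tupleCh k (partitionOf x)) (cong tupleCh (encode-corAt-partitionOf x))

  partitionOf-surjective : ∀ k {a b} π → Counted d (suc k) a b π →
                           Σ (LayerTuple (suc k)) λ x → tupleCor x ≡ a × tupleCh x ≡ b × π ≗ partitionOf x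
  partitionOf-surjective k π (partition , cor≡a , ch≡b) =
      encode (suc k) (corAt π)
    , trans (sym (cor≡tupleCor k π)) cor≡a
    , trans (sym (chWeight≡tupleCh k π)) ch≡b
    , λ v → trans (sym (fromCorners-corAt (suc k) partition v))
                  (fromCorners-cong (suc k) (sym ∘ decode-encode-supported (suc k) (corAt-supported (suc k) partition)) v)

  partitionOf-injective : ∀ {m} (x y : LayerTuple m) → partitionOf x ≗ partitionOf y → x ≡ y
  partitionOf-injective {m} x y px≗py = begin
    x                                ≡⟨ encode-corAt-partitionOf x ⟨
    encode m (corAt (partitionOf x)) ≡⟨ encode-cong m (λ v _ → corAt-cong px≗py v) ⟩
    encode m (corAt (partitionOf y)) ≡⟨ encode-corAt-partitionOf y ⟩
    y                                ∎
    where open ≡-Reasoning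

open LayerTuples

gf-LayerTuple : ∀ d n → GeneratingFunction (LayerTuple (suc d) n) (tupleCor (suc d)) (tupleCh (suc d))
                                           (rhs (suc d) n)
gf-LayerTuple d zero    = gf-one
gf-LayerTuple d (suc n) = gf-⊛ (gf-LayerTuple d n) (subst (gf-layer ∘ (geomInv (suc n) ^ˢ_)) binomial
                                                          (gf-Vec (suc n) (length (layer (suc d) n))))
  where
  gf-layer : Series → Set
  gf-layer = GeneratingFunction (Vec ℕ (length (layer (suc d) n))) Vec.sum (λ xs → suc n * Vec.sum xs)
  binomial : length (layer (suc d) n) ≡ (suc n + suc d ∸ 2) C (suc d ∸ 1)
  binomial = trans (length-layer d n) (cong (λ k → (k ∸ 1) C d) (sym (+-suc n d)))

corollary5p6 : (m d : ℕ) → 1 ≤ m → 1 ≤ d → (a b : ℕ) →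
    HasCard (Counted d m a b) (rhs d m a b)
corollary5p6 (suc k) (suc d) _ _ =
  hasCard-image (Counted (suc d) (suc k)) (gf-LayerTuple d (suc k)) (partitionOf (suc d))
    (partitionOf-counted (suc d) k) (partitionOf-surjective (suc d) k) (partitionOf-injective (suc d))
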